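{- For all integers $\ell\ge 0$ and $t\ge 4$, every graph that is both $(P_t+\ell P_1)$-free and $K_3$-free is $(t+\ell-2)$-colourable.
   Context: All graphs are finite and simple. A graph is $F$-free if it has no induced subgraph isomorphic to $F$. $P_t$ is the path on $t$ vertices, $P_t+\ell P_1$ is the disjoint union of $P_t$ with $\ell$ isolated vertices, and $K_3$ is the triangle. -}

module Defs where

open import Data.Nat using (ℕ; zero; suc; _+_; _∸_; _<_)
open import Data.Fin using (Fin; toℕ)
open import Data.Bool using (Bool; true; false; _∧_; _∨_)
open import Data.Nat using (_≡ᵇ_; _<ᵇ_)
open import Relation.Binary.PropositionalEquality using (_≡_; _≢_)
open import Relation.Nullary using (¬_)
open import Data.Product using (Σ; _×_)
open import Function.Definitions using (Injective)

record Graph (n : ℕ) : Set where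
  field
    adj   : Fin n → Fin n → Bool
    sym   : ∀ u v → adj u v ≡ adj v u
    irrefl : ∀ v → adj v v ≡ false
open Graph public

_⊑ᵢ_ : ∀ {k n} → Graph k → Graph n → Set
_⊑ᵢ_ {k} {n} H G =
  Σ (Fin k → Fin n) λ f →
    Injective _≡_ _≡_ f × (∀ i j → adj G (f i) (f j) ≡ adj H i j)

_isFreeOf_ : ∀ {n k} → Graph n → Graph k → Set
G isFreeOf F = ¬ (F ⊑ᵢ G)

K₃ : Graph 3
K₃ = record
  { adj = λ i j → not≡ (toℕ i) (toℕ j)
  ; sym = λ i j → sym≡ (toℕ i) (toℕ j)
  ; irrefl = λ v → irr (toℕ v)
  }
  where
  not≡ : ℕ → ℕ → Bool
  not≡ zero zero = false
  not≡ zero (suc b) = true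
  not≡ (suc a) zero = true
  not≡ (suc a) (suc b) = not≡ a b
  sym≡ : ∀ a b → not≡ a b ≡ not≡ b a
  sym≡ zero zero = Relation.Binary.PropositionalEquality.refl
  sym≡ zero (suc b) = Relation.Binary.PropositionalEquality.refl
  sym≡ (suc a) zero = Relation.Binary.PropositionalEquality.refl
  sym≡ (suc a) (suc b) = sym≡ a b
  irr : ∀ a → not≡ a a ≡ false
  irr zero = Relation.Binary.PropositionalEquality.refl
  irr (suc a) = irr a

consecutive : ℕ → ℕ → Bool
consecutive i j = (suc i ≡ᵇ j) ∨ (suc j ≡ᵇ i)

consecutive-sym : ∀ i j → consecutive i j ≡ consecutive j i
consecutive-sym i j with suc i ≡ᵇ j | suc j ≡ᵇ i
... | true  | true  = Relation.Binary.PropositionalEquality.refl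
... | true  | false = Relation.Binary.PropositionalEquality.refl
... | false | true  = Relation.Binary.PropositionalEquality.refl
... | false | false = Relation.Binary.PropositionalEquality.refl

consecutive-irrefl : ∀ i → consecutive i i ≡ false
consecutive-irrefl zero = Relation.Binary.PropositionalEquality.refl
consecutive-irrefl (suc i) = consecutive-irrefl i

-- P_t + ℓ P₁ on Fin (t + ℓ): vertices 0,…,t-1 form the path 0-1-…-(t-1);
-- vertices t,…,t+ℓ-1 are isolated.
PathPlusIsolated : (t ℓ : ℕ) → Graph (t + ℓ)
PathPlusIsolated t ℓ = record
  { adj = λ i j → (toℕ i <ᵇ t) ∧ (toℕ j <ᵇ t) ∧ consecutive (toℕ i) (toℕ j)
  ; sym = λ i j → symAdj (toℕ i) (toℕ j)
  ; irrefl = λ v → irrAdj (toℕ v)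
  }
  where
  open Relation.Binary.PropositionalEquality using (refl; cong)
  symAdj : ∀ a b → ((a <ᵇ t) ∧ (b <ᵇ t) ∧ consecutive a b) ≡ ((b <ᵇ t) ∧ (a <ᵇ t) ∧ consecutive b a)
  symAdj a b with a <ᵇ t | b <ᵇ t
  ... | true  | true  = consecutive-sym a b
  ... | true  | false = refl
  ... | false | true  = refl
  ... | false | false = refl
  irrAdj : ∀ a → ((a <ᵇ t) ∧ (a <ᵇ t) ∧ consecutive a a) ≡ false
  irrAdj a with a <ᵇ t
  ... | true  = consecutive-irrefl a
  ... | false = refl

_isColourableWith_ : ∀ {n} → Graph n → ℕ → Set
_isColourableWith_ {n} G k =
  Σ (Fin n → Fin k) λ c → ∀ u v → adj G u v ≡ true → c u ≢ c v

module Submission where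

-- Induction on ℓ: a copy of P_t + (ℓ-1)P₁ in G - N[v] together with v is a copy of
-- P_t + ℓP₁ in G, and N(v) is independent as G is triangle-free, so v and N(v) cost one
-- new colour. For ℓ = 0 colour each component by Gyárfás' argument from a root v: N(v)
-- gets one colour, and each component of G - N[v] is coloured recursively together with
-- a neighbour u of v adjacent to it, from which induced paths are one vertex shorter than
-- from v (prepending v to such a path keeps it induced). Once no induced P₄ starts at v,
-- G - N[v] is independent: an edge xy there, a common neighbour a of v and x, and v give
-- a triangle axy or an induced path vaxy. This uses t - 2 colours.

open import Defs
open import Data.Bool using (Bool; true; false; not; _∧_; _∨_; if_then_else_)
open import Data.Bool.Properties using (∧-zeroʳ; ∨-zeroʳ; ⇔→≡)
open import Data.Empty using (⊥; ⊥-elim)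
open import Data.Fin using (Fin; zero; suc; toℕ; fromℕ<; _↑ˡ_; _↑ʳ_; splitAt)
open import Data.Fin.Properties
  using ( _≟_; fromℕ<-injective; toℕ-↑ˡ; toℕ-↑ʳ; toℕ<n
        ; splitAt-↑ˡ; splitAt-↑ʳ; splitAt⁻¹-↑ˡ; splitAt⁻¹-↑ʳ)
import Data.Fin.Subset as Subset
open import Data.Fin.Subset.Properties using (p⊂q⇒∣p∣<∣q∣; ∣p∣≤n)
open import Data.Nat using (ℕ; zero; suc; _+_; _∸_; _≤_; _<_; z≤n; s≤s; _<ᵇ_)
open import Data.Nat.Properties using (≤-refl; ≤-trans; ≤-pred; +-comm; <⇒≢; >⇒≢; m<n⇒m<1+n)
open import Data.Product using (∃; _×_; _,_; proj₁; proj₂)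
open import Data.Sum using (_⊎_; inj₁; inj₂; [_,_]′)
open import Data.Vec using (tabulate)
open import Data.Vec.Properties using (lookup∘tabulate; lookup⇒[]=; []=⇒lookup)
open import Function.Bundles using (mk⇔)
open import Function.Definitions using (Injective)
open import Relation.Nullary using (¬_; does; yes; no)
open import Relation.Nullary.Decidable using (dec-true; dec-false)
open import Relation.Binary.PropositionalEquality as ≡
  using (_≡_; _≢_; _≗_; refl; trans; cong; cong₂; subst; ≢-sym)

true≢false : true ≢ false
true≢false ()

∧-intro : ∀ {a b} → a ≡ true → b ≡ true → (a ∧ b) ≡ true
∧-intro refl refl = refl

∧-elimˡ : ∀ a {b} → (a ∧ b) ≡ true → a ≡ true
∧-elimˡ true _ = refl

∧-elimʳ : ∀ a {b} → (a ∧ b) ≡ true → b ≡ true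
∧-elimʳ true e = e

∨-elim : ∀ a {b} → (a ∨ b) ≡ true → a ≡ true ⊎ b ≡ true
∨-elim true  _ = inj₁ refl
∨-elim false e = inj₂ e

VertexSet : ℕ → Set
VertexSet n = Fin n → Bool

infix 4 _⊆_ _==_

_⊆_ : ∀ {n} → VertexSet n → VertexSet n → Set
P ⊆ Q = ∀ {i} → P i ≡ true → Q i ≡ true

_==_ : ∀ {n} → Fin n → Fin n → Bool
i == j = does (i ≟ j)

==⇒≡ : ∀ {n} {i j : Fin n} → (i == j) ≡ true → i ≡ j
==⇒≡ {i = i} {j} e with i ≟ j
... | yes i≡j = i≡j

==-refl : ∀ {n} (i : Fin n) → (i == i) ≡ true
==-refl i = dec-true (i ≟ i) refl

-- The first element of P, or the last vertex if P is empty.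
first : ∀ {n} → VertexSet (suc n) → Fin (suc n)
first {zero}  P = zero
first {suc n} P = if P zero then zero else suc (first (λ i → P (suc i)))

first-∈ : ∀ {n} (P : VertexSet (suc n)) {i} → P i ≡ true → P (first P) ≡ true
first-∈ {zero}  P {zero} Pi = Pi
first-∈ {suc n} P {i} Pi with P zero in P₀
... | true = P₀
first-∈ {suc n} P {zero}  Pi | false = ⊥-elim (true≢false (trans (≡.sym Pi) P₀))
first-∈ {suc n} P {suc i} Pi | false = first-∈ (λ k → P (suc k)) Pi

first-cong : ∀ {n} {P Q : VertexSet (suc n)} → P ≗ Q → first P ≡ first Q
first-cong {zero}  _ = refl
first-cong {suc n} {P} {Q} P≗Q rewrite P≗Q zero with Q zero
... | true  = refl
... | false = cong suc (first-cong (λ i → P≗Q (suc i)))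

any : ∀ {n} → VertexSet (suc n) → Bool
any P = P (first P)

∈-tabulate : ∀ {n} {P : VertexSet n} {i} → P i ≡ true → i Subset.∈ tabulate P
∈-tabulate {P = P} {i} Pi = lookup⇒[]= i (tabulate P) (trans (lookup∘tabulate P i) Pi)

∈-tabulate⁻ : ∀ {n} {P : VertexSet n} {i} → i Subset.∈ tabulate P → P i ≡ true
∈-tabulate⁻ {P = P} {i} i∈P = trans (≡.sym (lookup∘tabulate P i)) ([]=⇒lookup i∈P)

opaque
  size : ∀ {n} → VertexSet n → ℕ
  size P = Subset.∣ tabulate P ∣

  size-< : ∀ {n} {P Q : VertexSet n} {i} → P ⊆ Q → Q i ≡ true → P i ≡ false → size P < size Q
  size-< {i = i} P⊆Q Qi Pi = p⊂q⇒∣p∣<∣q∣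
    ( (λ i∈P → ∈-tabulate (P⊆Q (∈-tabulate⁻ i∈P)))
    , i , ∈-tabulate Qi , λ i∈P → true≢false (trans (≡.sym (∈-tabulate⁻ i∈P)) Pi))

  size≤n : ∀ {n} (P : VertexSet n) → size P ≤ n
  size≤n P = ∣p∣≤n (tabulate P)

size-pos : ∀ {n} {P : VertexSet n} {i} → P i ≡ true → 1 ≤ size P
size-pos {P = P} Pi = ≤-trans (s≤s z≤n) (size-< {P = λ _ → false} {Q = P} (λ ()) Pi refl)

module _ {m : ℕ} (G : Graph (suc m)) where

  Vertex : Set
  Vertex = Fin (suc m)

  adj-sym : ∀ {x y} → adj G x y ≡ true → adj G y x ≡ true
  adj-sym {x} {y} xy = trans (sym G y x) xy

  nonadj-sym : ∀ {x y} → adj G x y ≡ false → adj G y x ≡ false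
  nonadj-sym {x} {y} xy = trans (sym G y x) xy

  adj⇒≢ : ∀ {x y} → adj G x y ≡ true → x ≢ y
  adj⇒≢ {x} xy refl = true≢false (trans (≡.sym xy) (irrefl G x))

  separates : ∀ {w x y} → adj G w x ≡ true → adj G w y ≡ false → x ≢ y
  separates wx wy refl = true≢false (trans (≡.sym wx) wy)

  no-triangle : G isFreeOf K₃ → ∀ {x y z} →
    adj G x y ≡ true → adj G y z ≡ true → adj G x z ≡ true → ⊥
  no-triangle K₃-free {x} {y} {z} xy yz xz = K₃-free (f , injective , induced)
    where
    f : Fin 3 → Vertex
    f zero = x
    f (suc zero) = y
    f (suc (suc zero)) = z
    induced : ∀ i j → adj G (f i) (f j) ≡ adj K₃ i j
    induced zero zero = irrefl G x
    induced zero (suc zero) = xy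
    induced zero (suc (suc zero)) = xz
    induced (suc zero) zero = adj-sym xy
    induced (suc zero) (suc zero) = irrefl G y
    induced (suc zero) (suc (suc zero)) = yz
    induced (suc (suc zero)) zero = adj-sym xz
    induced (suc (suc zero)) (suc zero) = adj-sym yz
    induced (suc (suc zero)) (suc (suc zero)) = irrefl G z
    K₃-complete : ∀ i j → adj K₃ i j ≡ false → i ≡ j
    K₃-complete zero zero _ = refl
    K₃-complete (suc zero) (suc zero) _ = refl
    K₃-complete (suc (suc zero)) (suc (suc zero)) _ = refl
    injective : Injective _≡_ _≡_ f
    injective {i} {j} fi≡fj = K₃-complete i j
      (trans (≡.sym (induced i j)) (trans (cong (adj G (f i)) (≡.sym fi≡fj)) (irrefl G (f i))))

  data Walk (S : VertexSet (suc m)) (x : Vertex) : Vertex → Set where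
    here : Walk S x x
    step : ∀ {y z} → Walk S x y → S z ≡ true → adj G y z ≡ true → Walk S x z

  edge : ∀ {S x y} → S y ≡ true → adj G x y ≡ true → Walk S x y
  edge = step here

  _++ʷ_ : ∀ {S x y z} → Walk S x y → Walk S y z → Walk S x z
  W ++ʷ here = W
  W ++ʷ step W′ Sz yz = step (W ++ʷ W′) Sz yz

  walk-⊆ : ∀ {P Q x y} → P ⊆ Q → Walk P x y → Walk Q x y
  walk-⊆ P⊆Q here = here
  walk-⊆ P⊆Q (step W Sz yz) = step (walk-⊆ P⊆Q W) (P⊆Q Sz) yz

  walk-end : ∀ {S x y} → Walk S x y → S x ≡ true → S y ≡ true
  walk-end here Sx = Sx
  walk-end (step _ Sz _) _ = Sz

  walk-reverse : ∀ {S x y} → Walk S x y → S x ≡ true → Walk S y x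
  walk-reverse here _ = here
  walk-reverse (step W Sz yz) Sx = edge (walk-end W Sx) (adj-sym yz) ++ʷ walk-reverse W Sx

  Connected : VertexSet (suc m) → Vertex → Set
  Connected S v = ∀ {z} → S z ≡ true → Walk S v z

  opaque
    _-_ : VertexSet (suc m) → Vertex → VertexSet (suc m)
    B - x = λ z → B z ∧ not (x == z)

    -⊆ : ∀ {B x} → (B - x) ⊆ B
    -⊆ {B} {x} {z} e = ∧-elimˡ (B z) e

    -intro : ∀ {B x z} → B z ≡ true → x ≢ z → (B - x) z ≡ true
    -intro {x = x} {z} Bz x≢z rewrite Bz | dec-false (x ≟ z) x≢z = refl

    -removes : ∀ B x → (B - x) x ≡ false
    -removes B x rewrite ==-refl x = ∧-zeroʳ (B x)

  first-step : ∀ {B x z} → Walk B x z →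
    x ≡ z ⊎ ∃ λ w → (B - x) w ≡ true × adj G x w ≡ true × Walk (B - x) w z
  first-step here = inj₁ refl
  first-step {x = x} (step {z = z} W Bz yz) with x ≟ z
  ... | yes x≡z = inj₁ x≡z
  ... | no x≢z with first-step W
  ...   | inj₁ refl = inj₂ (z , -intro Bz x≢z , yz , here)
  ...   | inj₂ (w , w∈ , xw , W′) = inj₂ (w , w∈ , xw , step W′ (-intro Bz x≢z) yz)

  -- Depth-first search that deletes each visited vertex: the fuel only has to
  -- exceed the number of vertices still available.
  reach : ℕ → VertexSet (suc m) → Vertex → VertexSet (suc m)
  reach zero    B x z = x == z
  reach (suc f) B x z = (x == z) ∨ any (λ w → (B - x) w ∧ adj G x w ∧ reach f (B - x) w z)

  reach-sound : ∀ f {B x z} → reach f B x z ≡ true → Walk B x z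
  reach-sound zero {x = x} {z} e with ==⇒≡ {i = x} {z} e
  ... | refl = here
  reach-sound (suc f) {B} {x} {z} e with ∨-elim (x == z) e
  ... | inj₁ x=z with ==⇒≡ {i = x} {z} x=z
  ...   | refl = here
  reach-sound (suc f) {B} {x} {z} e | inj₂ found =
    edge (-⊆ (∧-elimˡ ((B - x) w) found)) (∧-elimˡ (adj G x w) rest)
      ++ʷ walk-⊆ -⊆ (reach-sound f (∧-elimʳ (adj G x w) rest))
    where
    w : Vertex
    w = first (λ w → (B - x) w ∧ adj G x w ∧ reach f (B - x) w z)
    rest : (adj G x w ∧ reach f (B - x) w z) ≡ true
    rest = ∧-elimʳ ((B - x) w) found

  reach-complete : ∀ f {B x z} → B x ≡ true → size B ≤ f → Walk B x z → reach f B x z ≡ true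
  reach-complete zero Bx size≤0 _ with ≤-trans (size-pos Bx) size≤0
  ... | ()
  reach-complete (suc f) {B} {x} {z} Bx size≤ W with first-step W
  ... | inj₁ refl rewrite ==-refl x = refl
  ... | inj₂ (w , w∈ , xw , W′) =
    trans (cong ((x == z) ∨_) (first-∈ next (∧-intro w∈ (∧-intro xw reach-w)))) (∨-zeroʳ (x == z))
    where
    next : VertexSet (suc m)
    next w = (B - x) w ∧ adj G x w ∧ reach f (B - x) w z
    reach-w : reach f (B - x) w z ≡ true
    reach-w = reach-complete f w∈ (≤-pred (≤-trans (size-< -⊆ Bx (-removes B x)) size≤)) W′

  opaque
    component : VertexSet (suc m) → Vertex → VertexSet (suc m)
    component B x = reach (suc m) B x

    component-walk : ∀ {B x z} → component B x z ≡ true → Walk B x z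
    component-walk = reach-sound (suc m)

    walk-component : ∀ {B x z} → B x ≡ true → Walk B x z → component B x z ≡ true
    walk-component {B} Bx = reach-complete (suc m) Bx (size≤n B)

  component-⊆ : ∀ {B x} → B x ≡ true → component B x ⊆ B
  component-⊆ Bx e = walk-end (component-walk e) Bx

  component-connected : ∀ {B x} → B x ≡ true → Connected (component B x) x
  component-connected {B} {x} Bx e = lift (component-walk e)
    where
    lift : ∀ {z} → Walk B x z → Walk (component B x) x z
    lift here = here
    lift (step W Bz yz) = step (lift W) (walk-component Bx (step W Bz yz)) yz

  component-edge : ∀ {B x y} → B x ≡ true → B y ≡ true → adj G x y ≡ true →
    component B x ≗ component B y
  component-edge Bx By xy z = ⇔→≡ (mk⇔
    (λ e → walk-component By (edge Bx (adj-sym xy) ++ʷ component-walk e))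
    (λ e → walk-component Bx (edge By xy ++ʷ component-walk e)))

  representative : VertexSet (suc m) → Vertex → Vertex
  representative B x = first (component B x)

  representative-edge : ∀ {B x y} → B x ≡ true → B y ≡ true → adj G x y ≡ true →
    representative B x ≡ representative B y
  representative-edge Bx By xy = first-cong (component-edge Bx By xy)

  module _ (B : VertexSet (suc m)) {x} (Bx : B x ≡ true) where

    walk-to-representative : Walk B x (representative B x)
    walk-to-representative = component-walk (first-∈ (component B x) (walk-component Bx here))

    representative-∈ : B (representative B x) ≡ true
    representative-∈ = walk-end walk-to-representative Bx

    ∈-component-representative : component B (representative B x) x ≡ true
    ∈-component-representative =
      walk-component representative-∈ (walk-reverse walk-to-representative Bx)

  ProperOn : VertexSet (suc m) → (Vertex → ℕ) → Set
  ProperOn S c = ∀ {x y} → S x ≡ true → S y ≡ true → adj G x y ≡ true → c x ≢ c y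

  ProperOn-⊆ : ∀ {P Q c} → P ⊆ Q → ProperOn Q c → ProperOn P c
  ProperOn-⊆ P⊆Q proper Px Py = proper (P⊆Q Px) (P⊆Q Py)

  Colouring : VertexSet (suc m) → ℕ → Set
  Colouring S K = ∃ λ (c : Vertex → ℕ) → (∀ x → c x < K) × ProperOn S c

  componentwise : VertexSet (suc m) → (Vertex → Vertex → ℕ) → Vertex → ℕ
  componentwise B c x = c (representative B x) x

  componentwise-proper : ∀ {B c} → (∀ {r} → B r ≡ true → ProperOn (component B r) (c r)) →
    ProperOn B (componentwise B c)
  componentwise-proper {B} {c} proper {x} {y} Bx By xy cx≡cy =
    proper (representative-∈ B By) x∈ (∈-component-representative B By) xy
      (trans (cong (λ r → c r x) (≡.sym (representative-edge Bx By xy))) cx≡cy)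
    where
    x∈ : component B (representative B y) x ≡ true
    x∈ = walk-component (representative-∈ B By)
      (walk-reverse (walk-to-representative B By) By ++ʷ edge Bx (adj-sym xy))

  record InducedPath (S : VertexSet (suc m)) (k : ℕ) : Set where
    field
      vertex    : Fin k → Vertex
      inside    : ∀ i → S (vertex i) ≡ true
      injective : Injective _≡_ _≡_ vertex
      induced   : ∀ i j → adj G (vertex i) (vertex j) ≡ consecutive (toℕ i) (toℕ j)
  open InducedPath

  InducedPath-⊆ : ∀ {P Q k} → P ⊆ Q → InducedPath P k → InducedPath Q k
  InducedPath-⊆ P⊆Q π = record
    { vertex = vertex π
    ; inside = λ i → P⊆Q (inside π i)
    ; injective = injective π
    ; induced = induced π
    }

  -- k is the length: a rooted path of length k has k + 1 vertices.
  RootedPath : VertexSet (suc m) → ℕ → Vertex → Set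
  RootedPath S k v = ∃ λ (π : InducedPath S (suc k)) → vertex π zero ≡ v

  trivial-path : ∀ {S v} → S v ≡ true → RootedPath S 0 v
  trivial-path {v = v} Sv = record
    { vertex = λ _ → v
    ; inside = λ _ → Sv
    ; injective = λ { {zero} {zero} _ → refl }
    ; induced = λ { zero zero → irrefl G v }
    } , refl

  prepend : ∀ {S k v} (π : InducedPath S (suc k)) → S v ≡ true →
    adj G v (vertex π zero) ≡ true → (∀ i → adj G v (vertex π (suc i)) ≡ false) →
    (∀ i → vertex π (suc i) ≢ v) → RootedPath S (suc k) v
  prepend {S} {k} {v} π Sv v~π₀ v≁rest rest≢v =
    record { vertex = g ; inside = g-inside ; injective = g-injective ; induced = g-induced } , refl
    where
    g : Fin (suc (suc k)) → Vertex
    g zero = v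
    g (suc i) = vertex π i
    g-inside : ∀ i → S (g i) ≡ true
    g-inside zero = Sv
    g-inside (suc i) = inside π i
    π≢v : ∀ i → vertex π i ≢ v
    π≢v zero = adj⇒≢ (adj-sym v~π₀)
    π≢v (suc i) = rest≢v i
    g-injective : Injective _≡_ _≡_ g
    g-injective {zero} {zero} _ = refl
    g-injective {zero} {suc j} e = ⊥-elim (π≢v j (≡.sym e))
    g-injective {suc i} {zero} e = ⊥-elim (π≢v i e)
    g-injective {suc i} {suc j} e = cong suc (injective π e)
    g-induced : ∀ i j → adj G (g i) (g j) ≡ consecutive (toℕ i) (toℕ j)
    g-induced zero zero = irrefl G v
    g-induced zero (suc zero) = v~π₀
    g-induced zero (suc (suc j)) = v≁rest j
    g-induced (suc zero) zero = adj-sym v~π₀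
    g-induced (suc (suc i)) zero = nonadj-sym (v≁rest i)
    g-induced (suc i) (suc j) = induced π i j

  path₄ : ∀ {S v a x y} → S v ≡ true → S a ≡ true → S x ≡ true → S y ≡ true →
    adj G v a ≡ true → adj G a x ≡ true → adj G x y ≡ true →
    adj G v x ≡ false → adj G v y ≡ false → adj G a y ≡ false → RootedPath S 3 v
  path₄ Sv Sa Sx Sy va ax xy vx vy ay =
    prepend (proj₁ ax-y) Sv va (λ { zero → vx ; (suc zero) → vy })
      (λ { zero → separates (adj-sym xy) (nonadj-sym vy)
         ; (suc zero) → separates xy (nonadj-sym vx) })
    where
    x-y = prepend (proj₁ (trivial-path Sy)) Sx xy (λ ()) (λ ())
    ax-y = prepend (proj₁ x-y) Sa ax (λ { zero → ay }) (λ { zero → ≢-sym (separates va vy) })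

  opaque
    _∖N[_] : VertexSet (suc m) → Vertex → VertexSet (suc m)
    S ∖N[ v ] = λ z → not (v == z) ∧ not (adj G v z) ∧ S z

    ∖N-intro : ∀ {S v z} → v ≢ z → adj G v z ≡ false → S z ≡ true → (S ∖N[ v ]) z ≡ true
    ∖N-intro {v = v} {z} v≢z v≁z Sz rewrite dec-false (v ≟ z) v≢z | v≁z | Sz = refl

    ∖N-elim : ∀ {S v z} → (S ∖N[ v ]) z ≡ true → v ≢ z × adj G v z ≡ false × S z ≡ true
    ∖N-elim {S} {v} {z} e with v ≟ z | adj G v z | S z
    ... | no v≢z | false | true = v≢z , refl , refl
    ∖N-elim () | yes _ | _     | _
    ∖N-elim () | no _  | true  | _
    ∖N-elim () | no _  | false | false

  ∖N-≢ : ∀ {S v z} → (S ∖N[ v ]) z ≡ true → v ≢ z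
  ∖N-≢ e = proj₁ (∖N-elim e)

  ∖N-≁ : ∀ {S v z} → (S ∖N[ v ]) z ≡ true → adj G v z ≡ false
  ∖N-≁ e = proj₁ (proj₂ (∖N-elim e))

  ∖N-⊆ : ∀ {S v} → (S ∖N[ v ]) ⊆ S
  ∖N-⊆ e = proj₂ (proj₂ (∖N-elim e))

  data Position (v x : Vertex) : Set where
    root      : v ≡ x → Position v x
    neighbour : v ≢ x → adj G v x ≡ true → Position v x
    far       : v ≢ x → adj G v x ≡ false → Position v x

  position : ∀ v x → Position v x
  position v x with v ≟ x | adj G v x in vx
  ... | yes v≡x | _     = root v≡x
  ... | no v≢x  | true  = neighbour v≢x vx
  ... | no v≢x  | false = far v≢x vx

  opaque
    extend : Vertex → ℕ → (Vertex → ℕ) → Vertex → ℕ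
    extend v K c x = if v == x then 0 else if adj G v x then K else c x

  module _ {v : Vertex} {K : ℕ} {c : Vertex → ℕ} where

    opaque
      unfolding extend

      extend-root : extend v K c v ≡ 0
      extend-root rewrite ==-refl v = refl

      extend-neighbour : ∀ {x} → v ≢ x → adj G v x ≡ true → extend v K c x ≡ K
      extend-neighbour {x} v≢x vx rewrite dec-false (v ≟ x) v≢x | vx = refl

      extend-far : ∀ {x} → v ≢ x → adj G v x ≡ false → extend v K c x ≡ c x
      extend-far {x} v≢x vx rewrite dec-false (v ≟ x) v≢x | vx = refl

    extend-< : (∀ x → c x < K) → ∀ x → extend v K c x < suc K
    extend-< c< x with position v x
    ... | root refl rewrite extend-root = s≤s z≤n
    ... | neighbour v≢x vx rewrite extend-neighbour v≢x vx = ≤-refl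
    ... | far v≢x vx rewrite extend-far v≢x vx = m<n⇒m<1+n (c< x)

    extend-proper : G isFreeOf K₃ → ∀ {S} → (∀ x → c x < K) → ProperOn (S ∖N[ v ]) c →
      ProperOn S (extend v K c)
    extend-proper K₃-free c< proper {x} {y} Sx Sy xy with position v x | position v y
    ... | root refl | root refl = λ _ → adj⇒≢ xy refl
    ... | root refl | neighbour v≢y vy
          rewrite extend-root | extend-neighbour v≢y vy = <⇒≢ (≤-trans (s≤s z≤n) (c< v))
    ... | root refl | far _ vy = ⊥-elim (true≢false (trans (≡.sym xy) vy))
    ... | neighbour v≢x vx | root refl
          rewrite extend-root | extend-neighbour v≢x vx = >⇒≢ (≤-trans (s≤s z≤n) (c< v))
    ... | neighbour _ vx | neighbour _ vy = ⊥-elim (no-triangle K₃-free vx xy vy)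
    ... | neighbour v≢x vx | far v≢y vy
          rewrite extend-neighbour v≢x vx | extend-far v≢y vy = >⇒≢ (c< y)
    ... | far _ vx | root refl = ⊥-elim (true≢false (trans (≡.sym (adj-sym xy)) vx))
    ... | far v≢x vx | neighbour v≢y vy
          rewrite extend-far v≢x vx | extend-neighbour v≢y vy = <⇒≢ (c< x)
    ... | far v≢x vx | far v≢y vy
          rewrite extend-far v≢x vx | extend-far v≢y vy =
            proper (∖N-intro v≢x vx Sx) (∖N-intro v≢y vy Sy) xy

  extend-colouring : G isFreeOf K₃ → ∀ {S v K} → Colouring (S ∖N[ v ]) K → Colouring S (suc K)
  extend-colouring K₃-free {v = v} {K} (c , c< , proper) =
    extend v K c , extend-< c< , extend-proper K₃-free c< proper

  common-neighbour : ∀ {S v} → S v ≡ true → ¬ RootedPath S 3 v → ∀ {z} → Walk S v z →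
    v ≢ z → adj G v z ≡ false → ∃ λ a → S a ≡ true × adj G v a ≡ true × adj G a z ≡ true
  common-neighbour Sv no-path here v≢v _ = ⊥-elim (v≢v refl)
  common-neighbour {v = v} Sv no-path (step {y} {z} W Sz yz) v≢z vz with position v y
  ... | root refl = ⊥-elim (true≢false (trans (≡.sym yz) vz))
  ... | neighbour _ vy = y , walk-end W Sv , vy , yz
  ... | far v≢y vy with common-neighbour Sv no-path W v≢y vy
  ...   | a , Sa , va , ay with adj G a z in az
  ...     | true  = a , Sa , va , az
  ...     | false = ⊥-elim (no-path (path₄ Sv Sa (walk-end W Sv) Sz va ay yz vy vz az))

  ∖N-independent : G isFreeOf K₃ → ∀ {S v} → S v ≡ true → Connected S v → ¬ RootedPath S 3 v →
    ∀ {x y} → (S ∖N[ v ]) x ≡ true → (S ∖N[ v ]) y ≡ true → adj G x y ≡ true → ⊥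
  ∖N-independent K₃-free Sv S-connected no-path {x} {y} x∈ y∈ xy
    with common-neighbour Sv no-path (S-connected (∖N-⊆ x∈)) (∖N-≢ x∈) (∖N-≁ x∈)
  ... | a , Sa , va , ax with adj G a y in ay
  ...   | true  = no-triangle K₃-free ax xy ay
  ...   | false =
    no-path (path₄ Sv Sa (∖N-⊆ x∈) (∖N-⊆ y∈) va ax xy (∖N-≁ x∈) (∖N-≁ y∈) ay)

  opaque
    attaches : VertexSet (suc m) → Vertex → Vertex → VertexSet (suc m)
    attaches S v r w = S w ∧ adj G v w ∧ any (λ c → component (S ∖N[ v ]) r c ∧ adj G w c)

    attaches-intro : ∀ {S v r w c} → S w ≡ true → adj G v w ≡ true →
      component (S ∖N[ v ]) r c ≡ true → adj G w c ≡ true → attaches S v r w ≡ true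
    attaches-intro {S} {v} {r} {w} Sw vw c∈ wc = ∧-intro Sw (∧-intro vw
      (first-∈ (λ c → component (S ∖N[ v ]) r c ∧ adj G w c) (∧-intro c∈ wc)))

    attaches-elim : ∀ {S v r w} → attaches S v r w ≡ true →
      S w ≡ true × adj G v w ≡ true ×
      ∃ λ c → component (S ∖N[ v ]) r c ≡ true × adj G w c ≡ true
    attaches-elim {S} {v} {r} {w} e =
      ∧-elimˡ (S w) e , ∧-elimˡ (adj G v w) rest ,
      c , ∧-elimˡ (component (S ∖N[ v ]) r c) found , ∧-elimʳ (component (S ∖N[ v ]) r c) found
      where
      rest : (adj G v w ∧ any (λ c → component (S ∖N[ v ]) r c ∧ adj G w c)) ≡ true
      rest = ∧-elimʳ (S w) e
      neighbours : VertexSet (suc m)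
      neighbours c = component (S ∖N[ v ]) r c ∧ adj G w c
      c : Vertex
      c = first neighbours
      found : neighbours c ≡ true
      found = ∧-elimʳ (adj G v w) rest

  attach : VertexSet (suc m) → Vertex → Vertex → Vertex
  attach S v r = first (attaches S v r)

  opaque
    piece : VertexSet (suc m) → Vertex → Vertex → VertexSet (suc m)
    piece S v r z = component (S ∖N[ v ]) r z ∨ (attach S v r == z)

    component⊆piece : ∀ {S v r} → component (S ∖N[ v ]) r ⊆ piece S v r
    component⊆piece e rewrite e = refl

    attach∈piece : ∀ {S v r} → piece S v r (attach S v r) ≡ true
    attach∈piece {S} {v} {r} rewrite ==-refl (attach S v r) = ∨-zeroʳ _

    piece-elim : ∀ {S v r z} → piece S v r z ≡ true →
      component (S ∖N[ v ]) r z ≡ true ⊎ attach S v r ≡ z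
    piece-elim {S} {v} {r} {z} e with ∨-elim (component (S ∖N[ v ]) r z) e
    ... | inj₁ z∈ = inj₁ z∈
    ... | inj₂ z≡ = inj₂ (==⇒≡ z≡)

  module Piece {S v r} (Sv : S v ≡ true) (S-connected : Connected S v)
               (r∈ : (S ∖N[ v ]) r ≡ true) where

    private
      B = S ∖N[ v ]

    attachment : ∀ {z} → Walk S v z → component B r z ≡ true → ∃ λ w → attaches S v r w ≡ true
    attachment here v∈ = ⊥-elim (∖N-≢ (component-⊆ r∈ v∈) refl)
    attachment (step {y} W Sz yz) z∈ with position v y
    ... | root refl = ⊥-elim (true≢false (trans (≡.sym yz) (∖N-≁ (component-⊆ r∈ z∈))))
    ... | neighbour _ vy = y , attaches-intro (walk-end W Sv) vy z∈ yz
    ... | far v≢y vy = attachment W (walk-component r∈ (component-walk z∈ ++ʷ edge y∈ (adj-sym yz)))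
      where
      y∈ : B y ≡ true
      y∈ = ∖N-intro v≢y vy (walk-end W Sv)

    attach-attaches : attaches S v r (attach S v r) ≡ true
    attach-attaches = first-∈ (attaches S v r)
      (proj₂ (attachment (S-connected (∖N-⊆ r∈)) (walk-component r∈ here)))

    piece-⊆ : piece S v r ⊆ S
    piece-⊆ e with piece-elim e
    ... | inj₁ z∈ = ∖N-⊆ (component-⊆ r∈ z∈)
    ... | inj₂ refl = proj₁ (attaches-elim attach-attaches)

    piece-connected : Connected (piece S v r) (attach S v r)
    piece-connected e with piece-elim e
    ... | inj₂ refl = here
    ... | inj₁ z∈ with attaches-elim attach-attaches
    ...   | _ , _ , c , c∈ , attach~c =
      edge (component⊆piece c∈) attach~c ++ʷ walk-⊆ component⊆piece
        (walk-reverse (component-connected r∈ c∈) (walk-component r∈ here)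
          ++ʷ component-connected r∈ z∈)

    rooted-path-from-piece : ∀ {k} → RootedPath (piece S v r) k (attach S v r) → RootedPath S (suc k) v
    rooted-path-from-piece (π , π₀≡attach) =
      prepend (InducedPath-⊆ piece-⊆ π) Sv
        (subst (λ w → adj G v w ≡ true) (≡.sym π₀≡attach)
          (proj₁ (proj₂ (attaches-elim attach-attaches))))
        (λ i → ∖N-≁ (rest∈B i))
        (λ i → ≢-sym (∖N-≢ (rest∈B i)))
      where
      rest∈B : ∀ i → B (vertex π (suc i)) ≡ true
      rest∈B i with piece-elim (inside π (suc i))
      ... | inj₁ z∈ = component-⊆ r∈ z∈
      ... | inj₂ attach≡ with injective π (trans π₀≡attach attach≡)
      ...   | ()

  gyarfas : ℕ → VertexSet (suc m) → Vertex → Vertex → ℕ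
  gyarfas zero    S v = extend v 1 (λ _ → 0)
  gyarfas (suc j) S v =
    extend v (2 + j) (componentwise (S ∖N[ v ]) λ r → gyarfas j (piece S v r) (attach S v r))

  gyarfas-< : ∀ j S v x → gyarfas j S v x < 2 + j
  gyarfas-< zero    S v = extend-< (λ _ → s≤s z≤n)
  gyarfas-< (suc j) S v = extend-< (λ x → gyarfas-< j _ _ x)

  gyarfas-proper : G isFreeOf K₃ → ∀ j {S v} → S v ≡ true → Connected S v →
    ¬ RootedPath S (3 + j) v → ProperOn S (gyarfas j S v)
  gyarfas-proper K₃-free zero Sv S-connected no-path =
    extend-proper K₃-free (λ _ → s≤s z≤n)
      (λ x∈ y∈ xy _ → ∖N-independent K₃-free Sv S-connected no-path x∈ y∈ xy)
  gyarfas-proper K₃-free (suc j) {S} {v} Sv S-connected no-path =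
    extend-proper K₃-free (λ x → gyarfas-< j _ _ x) (componentwise-proper piece-proper)
    where
    piece-proper : ∀ {r} → (S ∖N[ v ]) r ≡ true →
      ProperOn (component (S ∖N[ v ]) r) (gyarfas j (piece S v r) (attach S v r))
    piece-proper r∈ = ProperOn-⊆ component⊆piece
      (gyarfas-proper K₃-free j attach∈piece piece-connected (λ π → no-path (rooted-path-from-piece π)))
      where open Piece Sv S-connected r∈

  record InducedCopy (S : VertexSet (suc m)) (t ℓ : ℕ) : Set where
    field
      path                 : InducedPath S t
      isolated             : Fin ℓ → Vertex
      isolated-inside      : ∀ i → S (isolated i) ≡ true
      isolated-injective   : Injective _≡_ _≡_ isolated
      path≢isolated        : ∀ i k → vertex path i ≢ isolated k
      isolated-independent : ∀ i k → adj G (isolated i) (isolated k) ≡ false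
      path≁isolated        : ∀ i k → adj G (vertex path i) (isolated k) ≡ false

  path⇒copy : ∀ {S t} → InducedPath S t → InducedCopy S t 0
  path⇒copy π = record
    { path = π ; isolated = λ () ; isolated-inside = λ () ; isolated-injective = λ { {()} }
    ; path≢isolated = λ _ () ; isolated-independent = λ () ; path≁isolated = λ _ () }

  copy-∖N : ∀ {S v t ℓ} → S v ≡ true → InducedCopy (S ∖N[ v ]) t ℓ → InducedCopy S t (suc ℓ)
  copy-∖N {S} {v} {t} {ℓ} Sv C = record
    { path = InducedPath-⊆ ∖N-⊆ path
    ; isolated = h
    ; isolated-inside = h-inside
    ; isolated-injective = h-injective
    ; path≢isolated = path≢h
    ; isolated-independent = h-independent
    ; path≁isolated = path≁h
    }
    where
    open InducedCopy C
    h : Fin (suc ℓ) → Vertex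
    h zero = v
    h (suc i) = isolated i
    h-inside : ∀ i → S (h i) ≡ true
    h-inside zero = Sv
    h-inside (suc i) = ∖N-⊆ (isolated-inside i)
    h-injective : Injective _≡_ _≡_ h
    h-injective {zero} {zero} _ = refl
    h-injective {zero} {suc k} e = ⊥-elim (∖N-≢ (isolated-inside k) e)
    h-injective {suc i} {zero} e = ⊥-elim (∖N-≢ (isolated-inside i) (≡.sym e))
    h-injective {suc i} {suc k} e = cong suc (isolated-injective e)
    path≢h : ∀ i k → vertex path i ≢ h k
    path≢h i zero e = ∖N-≢ (inside path i) (≡.sym e)
    path≢h i (suc k) = path≢isolated i k
    h-independent : ∀ i k → adj G (h i) (h k) ≡ false
    h-independent zero zero = irrefl G v
    h-independent zero (suc k) = ∖N-≁ (isolated-inside k)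
    h-independent (suc i) zero = nonadj-sym (∖N-≁ (isolated-inside i))
    h-independent (suc i) (suc k) = isolated-independent i k
    path≁h : ∀ i k → adj G (vertex path i) (h k) ≡ false
    path≁h i zero = nonadj-sym (∖N-≁ (inside path i))
    path≁h i (suc k) = path≁isolated i k

  path-free-colouring : G isFreeOf K₃ → ∀ j S → ¬ InducedPath S (4 + j) → Colouring S (2 + j)
  path-free-colouring K₃-free j S no-path =
    componentwise S (λ r → gyarfas j (component S r) r) ,
    (λ x → gyarfas-< j _ _ x) ,
    componentwise-proper λ r∈ →
      gyarfas-proper K₃-free j (walk-component r∈ here) (component-connected r∈)
        (λ (π , _) → no-path (InducedPath-⊆ (component-⊆ r∈) π))

  copy-free-colouring : G isFreeOf K₃ → ∀ j ℓ S → ¬ InducedCopy S (4 + j) ℓ →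
    Colouring S (ℓ + (2 + j))
  copy-free-colouring K₃-free j zero S no-copy =
    path-free-colouring K₃-free j S (λ π → no-copy (path⇒copy π))
  copy-free-colouring K₃-free j (suc ℓ) S no-copy =
    extend-colouring K₃-free (copy-free-colouring K₃-free j ℓ (S ∖N[ first S ]) λ C →
      no-copy (copy-∖N (first-∈ S (∖N-⊆ (inside (InducedCopy.path C) zero))) C))

  colouring⇒colourable : ∀ {K} → Colouring (λ _ → true) K → G isColourableWith K
  colouring⇒colourable (c , c< , proper) =
    (λ x → fromℕ< (c< x)) ,
    λ x y xy cx≡cy → proper refl refl xy (fromℕ<-injective (c x) (c y) (c< x) (c< y) cx≡cy)

  copy⇒embedding : ∀ {t ℓ} → InducedCopy (λ _ → true) t ℓ → PathPlusIsolated t ℓ ⊑ᵢ G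
  copy⇒embedding {t} {ℓ} C = embed , embed-injective , embed-induced
    where
    open InducedCopy C
    P : Graph (t + ℓ)
    P = PathPlusIsolated t ℓ

    embed : Fin (t + ℓ) → Vertex
    embed i = [ vertex path , isolated ]′ (splitAt t i)

    embed-path : ∀ i → embed (i ↑ˡ ℓ) ≡ vertex path i
    embed-path i = cong [ vertex path , isolated ]′ (splitAt-↑ˡ t i ℓ)

    embed-isolated : ∀ i → embed (t ↑ʳ i) ≡ isolated i
    embed-isolated i = cong [ vertex path , isolated ]′ (splitAt-↑ʳ t ℓ i)

    <ᵇ-true : ∀ {a b} → a < b → (a <ᵇ b) ≡ true
    <ᵇ-true {zero}  {suc b} _ = refl
    <ᵇ-true {suc a} {suc b} (s≤s a<b) = <ᵇ-true a<b

    +<ᵇ-false : ∀ a k → (a + k <ᵇ a) ≡ false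
    +<ᵇ-false zero    zero    = refl
    +<ᵇ-false zero    (suc k) = refl
    +<ᵇ-false (suc a) k       = +<ᵇ-false a k

    P-path : ∀ i j → adj P (i ↑ˡ ℓ) (j ↑ˡ ℓ) ≡ consecutive (toℕ i) (toℕ j)
    P-path i j rewrite toℕ-↑ˡ i ℓ | toℕ-↑ˡ j ℓ | <ᵇ-true (toℕ<n i) | <ᵇ-true (toℕ<n j) = refl

    P-path-isolated : ∀ i j → adj P (i ↑ˡ ℓ) (t ↑ʳ j) ≡ false
    P-path-isolated i j
      rewrite toℕ-↑ˡ i ℓ | toℕ-↑ʳ t j | +<ᵇ-false t (toℕ j) | <ᵇ-true (toℕ<n i) = refl

    P-isolated : ∀ i j → adj P (t ↑ʳ i) j ≡ false
    P-isolated i j rewrite toℕ-↑ʳ t i | +<ᵇ-false t (toℕ i) = refl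

    data Side : Fin (t + ℓ) → Set where
      on-path     : ∀ i → Side (i ↑ˡ ℓ)
      on-isolated : ∀ i → Side (t ↑ʳ i)

    side : ∀ i → Side i
    side i with splitAt t {ℓ} i in eq
    ... | inj₁ a rewrite ≡.sym (splitAt⁻¹-↑ˡ eq) = on-path a
    ... | inj₂ b rewrite ≡.sym (splitAt⁻¹-↑ʳ eq) = on-isolated b

    embed-injective : Injective _≡_ _≡_ embed
    embed-injective {i} {j} e with side i | side j
    ... | on-path a | on-path b =
      cong (_↑ˡ ℓ) (injective path (trans (≡.sym (embed-path a)) (trans e (embed-path b))))
    ... | on-path a | on-isolated b =
      ⊥-elim (path≢isolated a b (trans (≡.sym (embed-path a)) (trans e (embed-isolated b))))
    ... | on-isolated a | on-path b =
      ⊥-elim (path≢isolated b a (trans (≡.sym (embed-path b)) (trans (≡.sym e) (embed-isolated a))))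
    ... | on-isolated a | on-isolated b =
      cong (t ↑ʳ_) (isolated-injective (trans (≡.sym (embed-isolated a)) (trans e (embed-isolated b))))

    embed-induced : ∀ i j → adj G (embed i) (embed j) ≡ adj P i j
    embed-induced i j with side i | side j
    ... | on-path a | on-path b =
      trans (cong₂ (adj G) (embed-path a) (embed-path b))
        (trans (induced path a b) (≡.sym (P-path a b)))
    ... | on-path a | on-isolated b =
      trans (cong₂ (adj G) (embed-path a) (embed-isolated b))
        (trans (path≁isolated a b) (≡.sym (P-path-isolated a b)))
    ... | on-isolated a | on-path b =
      trans (cong₂ (adj G) (embed-isolated a) (embed-path b))
        (trans (nonadj-sym (path≁isolated b a)) (≡.sym (P-isolated a _)))
    ... | on-isolated a | on-isolated b =
      trans (cong₂ (adj G) (embed-isolated a) (embed-isolated b))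
        (trans (isolated-independent a b) (≡.sym (P-isolated a _)))

corollary5 : ∀ (ℓ t : ℕ) → 4 ≤ t → ∀ {n} (G : Graph n) →
    G isFreeOf PathPlusIsolated t ℓ → G isFreeOf K₃ →
    G isColourableWith (t + ℓ ∸ 2)
corollary5 ℓ (suc (suc (suc (suc j)))) (s≤s (s≤s (s≤s (s≤s _)))) {zero} G _ _ = (λ ()) , λ ()
corollary5 ℓ (suc (suc (suc (suc j)))) (s≤s (s≤s (s≤s (s≤s _)))) {suc m} G P-free K₃-free =
  subst (G isColourableWith_) (+-comm ℓ (2 + j))
    (colouring⇒colourable G (copy-free-colouring G K₃-free j ℓ (λ _ → true)
      (λ C → P-free (copy⇒embedding G C))))
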